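{- Let $R$ be a commutative ring with identity, and let $y_2,y_3,\dots$ and $z_2,z_3,\dots$ be sequences in $R$ such that every $y_n$ is idempotent ($y_n^2=y_n$) and, for every $m\geq 1$, $$z_{m+1}=y_{m+1}+s_m(y_2,\dots,y_m),$$ where $s_m\in\mathbb{Z}[x_2,x_3,\dots]$ is a polynomial with integer coefficients in the variables $x_2,\dots,x_m$ (so $s_1$ is an integer constant). Then: (i) for every $n\geq 1$ there is a compliform polynomial $t_n(x_2,\dots,x_n)$ such that $y_{n+1}=z_{n+1}+t_n(z_2,\dots,z_n)$; (ii) for every polynomial $u(x_2,\dots,x_n)$ with integer coefficients there is a compliform polynomial $v(x_2,\dots,x_n)$ such that $u(y_2,\dots,y_n)=v(z_2,\dots,z_n)$.
   Context: A polynomial is called compliform if it has integer coefficients and has degree at most $1$ in each of its variables. -}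

module Defs where

open import Algebra.Bundles using (CommutativeRing)
open import Data.Nat using (ℕ; zero; suc; _≤_)
open import Data.Integer using (ℤ; +_; -[1+_])
open import Data.Fin using (Fin; zero; suc)
open import Data.List using (List; []; _∷_)
open import Data.List.Relation.Unary.All using (All)
open import Data.Product using (_×_; proj₁; proj₂)

Monomial : ℕ → Set
Monomial k = Fin k → ℕ

-- A polynomial with integer coefficients in k variables, represented
-- as a finite formal sum of (coefficient, monomial) terms.
Poly : ℕ → Set
Poly k = List (ℤ × Monomial k)

IsCompliform : {k : ℕ} → Poly k → Set
IsCompliform p = All (λ t → (i : Fin _) → proj₂ t i ≤ 1) p

module _ {c ℓ} (R : CommutativeRing c ℓ) where
  open CommutativeRing R using (Carrier; _+_; _*_; -_; 0#; 1#)

  natCast : ℕ → Carrier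
  natCast zero = 0#
  natCast (suc n) = 1# + natCast n

  intCast : ℤ → Carrier
  intCast (+ n) = natCast n
  intCast -[1+ n ] = - natCast (suc n)

  pow : Carrier → ℕ → Carrier
  pow x zero = 1#
  pow x (suc n) = x * pow x n

  evalMono : {k : ℕ} → Monomial k → (Fin k → Carrier) → Carrier
  evalMono {zero} e a = 1#
  evalMono {suc k} e a = pow (a zero) (e zero) * evalMono (λ i → e (suc i)) (λ i → a (suc i))

  evalPoly : {k : ℕ} → Poly k → (Fin k → Carrier) → Carrier
  evalPoly [] a = 0#
  evalPoly (t ∷ p) a = intCast (proj₁ t) * evalMono (proj₂ t) a + evalPoly p a

-- Call x ∈ Compliform k if x is the value of a compliform polynomial at z₀, …, z₍ₖ₋₁₎,
-- i.e. x = a + b zₖ₋₁ with a, b ∈ Compliform (k - 1), down to integers at level 0.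
-- Since zₖ = yₖ + sₖ(y) with yₖ idempotent, zₖ² = (1 + 2w) zₖ − (w + w²) for w = sₖ(y),
-- so zₖ² ∈ Compliform (k + 1) as soon as w ∈ Compliform k; this quadratic relation makes
-- Compliform (k + 1) closed under products whenever Compliform k is.  By induction on k,
-- every Compliform k is a subring containing y₀, …, yₖ₋₁, hence every integer polynomial in
-- those y's, and in particular yₖ = zₖ − sₖ(y), is compliform in the z's.
module Submission where

open import Defs
open import Algebra.Bundles using (CommutativeRing)
open import Data.Nat using (ℕ)
open import Data.Fin using (toℕ)
open import Data.Product using (_×_; ∃)

open import Algebra.Solver.Ring.AlmostCommutativeRing using (fromCommutativeRing; _-Raw-AlmostCommutative⟶_)
import Algebra.Solver.Ring as RingSolver
import Algebra.Properties.Ring as RingProperties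
import Algebra.Properties.Semiring.Mult as SemiringMult
open import Data.Fin using (zero; suc)
open import Data.Fin.Properties using (toℕ<n; toℕ-inject₁; toℕ-fromℕ)
open import Data.Integer as ℤ using (+_; -[1+_]; _⊖_)
open import Data.Integer.Properties using ([1+m]⊖[1+n]≡m⊖n; suc-*; neg-distribˡ-*)
open import Data.List using ([]; _∷_; _++_; map)
open import Data.List.Relation.Unary.All using ([]; _∷_)
import Data.List.Relation.Unary.All as All
import Data.List.Relation.Unary.All.Properties as All
open import Data.Maybe using (Maybe)
import Data.Maybe
open import Data.Nat as ℕ using (zero; suc; _<_; z≤n)
open import Data.Nat.Properties using (≤-refl; m<1+n⇒m<n∨m≡n; +-suc)
open import Data.Product using (_,_; map₂)
open import Data.Sum using (inj₁; inj₂)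
open import Data.Vec.Functional using (Vector; tail; init; last)
open import Function.Base using (_∘_)
open import Level using (_⊔_)
open import Relation.Binary.Consequences using (dec⇒weaklyDec)
open import Relation.Binary.PropositionalEquality as ≡ using (_≡_)
open import Relation.Unary using (Pred; _∈_)

snoc : ∀ {a} {A : Set a} {k} → Vector A k → A → Vector A (suc k)
snoc {k = zero} e x _ = x
snoc {k = suc k} e x zero = e zero
snoc {k = suc k} e x (suc i) = snoc (tail e) x i

snoc-preserves : ∀ {a p} {A : Set a} (P : Pred A p) {k} {e : Vector A k} {x : A} →
                 (∀ i → e i ∈ P) → x ∈ P → ∀ i → snoc e x i ∈ P
snoc-preserves P {zero} e∈P x∈P _ = x∈P
snoc-preserves P {suc k} e∈P x∈P zero = e∈P zero
snoc-preserves P {suc k} e∈P x∈P (suc i) = snoc-preserves P (e∈P ∘ suc) x∈P i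

module _ {c ℓ} (R : CommutativeRing c ℓ) where
  open CommutativeRing R hiding (zero)
  open RingProperties ring using (-‿distribˡ-*; -‿involutive; -0#≈0#; -‿+-comm)
  open import Relation.Binary.Reasoning.Setoid setoid

  -‿cancel-+ˡ : ∀ x a b → (x + a) - (x + b) ≈ a - b
  -‿cancel-+ˡ x a b = begin
    (x + a) - (x + b)      ≈⟨ +-cong (+-comm x a) (sym (-‿+-comm x b)) ⟩
    (a + x) + (- x - b)    ≈⟨ +-assoc a x _ ⟩
    a + (x + (- x - b))    ≈⟨ +-congˡ (sym (+-assoc x (- x) _)) ⟩
    a + ((x - x) - b)      ≈⟨ +-congˡ (+-congʳ (-‿inverseʳ x)) ⟩
    a + (0# - b)           ≈⟨ +-congˡ (+-identityˡ _) ⟩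
    a - b                  ∎

  module IntegerCast where
    open SemiringMult semiring using (×-homo-+; ×1-homo-*) renaming (_×_ to _·_)

    natCast≡·1# : ∀ n → natCast R n ≡ n · 1#
    natCast≡·1# zero = ≡.refl
    natCast≡·1# (suc n) = ≡.cong (λ x → 1# + x) (natCast≡·1# n)

    natCast-+ : ∀ m n → natCast R (m ℕ.+ n) ≈ natCast R m + natCast R n
    natCast-+ m n = begin
      natCast R (m ℕ.+ n)         ≡⟨ natCast≡·1# (m ℕ.+ n) ⟩
      (m ℕ.+ n) · 1#              ≈⟨ ×-homo-+ 1# m n ⟩
      m · 1# + n · 1#             ≡⟨ ≡.sym (≡.cong₂ _+_ (natCast≡·1# m) (natCast≡·1# n)) ⟩
      natCast R m + natCast R n   ∎

    natCast-* : ∀ m n → natCast R (m ℕ.* n) ≈ natCast R m * natCast R n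
    natCast-* m n = begin
      natCast R (m ℕ.* n)         ≡⟨ natCast≡·1# (m ℕ.* n) ⟩
      (m ℕ.* n) · 1#              ≈⟨ ×1-homo-* m n ⟩
      m · 1# * n · 1#             ≡⟨ ≡.sym (≡.cong₂ _*_ (natCast≡·1# m) (natCast≡·1# n)) ⟩
      natCast R m * natCast R n   ∎

    intCast-⊖ : ∀ m n → intCast R (m ⊖ n) ≈ natCast R m - natCast R n
    intCast-⊖ m zero = sym (trans (+-congˡ -0#≈0#) (+-identityʳ _))
    intCast-⊖ zero (suc n) = sym (+-identityˡ _)
    intCast-⊖ (suc m) (suc n) = begin
      intCast R (suc m ⊖ suc n)                 ≡⟨ ≡.cong (intCast R) ([1+m]⊖[1+n]≡m⊖n m n) ⟩
      intCast R (m ⊖ n)                         ≈⟨ intCast-⊖ m n ⟩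
      natCast R m - natCast R n                 ≈⟨ sym (-‿cancel-+ˡ 1# _ _) ⟩
      natCast R (suc m) - natCast R (suc n)     ∎

    intCast-+ : ∀ i j → intCast R (i ℤ.+ j) ≈ intCast R i + intCast R j
    intCast-+ (+ m) (+ n) = natCast-+ m n
    intCast-+ (+ m) -[1+ n ] = intCast-⊖ m (suc n)
    intCast-+ -[1+ m ] (+ n) = trans (intCast-⊖ n (suc m)) (+-comm _ _)
    intCast-+ -[1+ m ] -[1+ n ] = begin
      - natCast R (suc (suc (m ℕ.+ n)))         ≡⟨ ≡.cong (λ k → - natCast R (suc k)) (≡.sym (+-suc m n)) ⟩
      - natCast R (suc m ℕ.+ suc n)             ≈⟨ -‿cong (natCast-+ (suc m) (suc n)) ⟩
      - (natCast R (suc m) + natCast R (suc n)) ≈⟨ sym (-‿+-comm _ _) ⟩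
      - natCast R (suc m) - natCast R (suc n)   ∎

    intCast-neg : ∀ i → intCast R (ℤ.- i) ≈ - intCast R i
    intCast-neg -[1+ n ] = sym (-‿involutive _)
    intCast-neg (+ zero) = sym -0#≈0#
    intCast-neg (+ suc n) = refl

    intCast-*ˡ : ∀ m j → intCast R (+ m ℤ.* j) ≈ natCast R m * intCast R j
    intCast-*ˡ zero j = sym (zeroˡ _)
    intCast-*ˡ (suc m) j = begin
      intCast R (+ suc m ℤ.* j)                    ≡⟨ ≡.cong (intCast R) (suc-* (+ m) j) ⟩
      intCast R (j ℤ.+ + m ℤ.* j)                  ≈⟨ intCast-+ j (+ m ℤ.* j) ⟩
      intCast R j + intCast R (+ m ℤ.* j)          ≈⟨ +-cong (sym (*-identityˡ _)) (intCast-*ˡ m j) ⟩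
      1# * intCast R j + natCast R m * intCast R j ≈⟨ sym (distribʳ _ _ _) ⟩
      natCast R (suc m) * intCast R j              ∎

    intCast-* : ∀ i j → intCast R (i ℤ.* j) ≈ intCast R i * intCast R j
    intCast-* (+ m) j = intCast-*ˡ m j
    intCast-* -[1+ m ] j = begin
      intCast R (-[1+ m ] ℤ.* j)                ≡⟨ ≡.cong (intCast R) (≡.sym (neg-distribˡ-* (+ suc m) j)) ⟩
      intCast R (ℤ.- (+ suc m ℤ.* j))           ≈⟨ intCast-neg (+ suc m ℤ.* j) ⟩
      - intCast R (+ suc m ℤ.* j)               ≈⟨ -‿cong (intCast-*ˡ (suc m) j) ⟩
      - (natCast R (suc m) * intCast R j)       ≈⟨ -‿distribˡ-* _ _ ⟩
      - natCast R (suc m) * intCast R j         ∎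

    intCast-homomorphism : ℤ.+-*-rawRing -Raw-AlmostCommutative⟶ fromCommutativeRing R
    intCast-homomorphism = record
      { ⟦_⟧ = intCast R ; +-homo = intCast-+ ; *-homo = intCast-* ; -‿homo = intCast-neg
      ; 0-homo = refl ; 1-homo = +-identityʳ 1# }

    intCast-≈? : ∀ i j → Maybe (intCast R i ≈ intCast R j)
    intCast-≈? i j = Data.Maybe.map (reflexive ∘ ≡.cong (intCast R)) (dec⇒weaklyDec ℤ._≟_ i j)

  open IntegerCast using (intCast-+; intCast-*; intCast-neg; intCast-homomorphism; intCast-≈?)
  open RingSolver ℤ.+-*-rawRing (fromCommutativeRing R) intCast-homomorphism intCast-≈?
    using (solve; _:=_; _:+_; _:*_; :-_; con)

  module _ {p} (P : Pred Carrier p) (1∈P : 1# ∈ P) (intCast∈P : ∀ n → intCast R n ∈ P)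
           (+-closed : ∀ {x x′} → x ∈ P → x′ ∈ P → x + x′ ∈ P)
           (*-closed : ∀ {x x′} → x ∈ P → x′ ∈ P → x * x′ ∈ P) where

    pow-closed : ∀ {x} n → x ∈ P → pow R x n ∈ P
    pow-closed zero x∈P = 1∈P
    pow-closed (suc n) x∈P = *-closed x∈P (pow-closed n x∈P)

    evalMono-closed : ∀ {k} (e : Monomial k) {a : Vector Carrier k} → (∀ i → a i ∈ P) → evalMono R e a ∈ P
    evalMono-closed {zero} e a∈P = 1∈P
    evalMono-closed {suc k} e a∈P = *-closed (pow-closed (e zero) (a∈P zero)) (evalMono-closed (tail e) (a∈P ∘ suc))

    evalPoly-closed : ∀ {k} (u : Poly k) {a : Vector Carrier k} → (∀ i → a i ∈ P) → evalPoly R u a ∈ P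
    evalPoly-closed [] a∈P = intCast∈P (+ 0)
    evalPoly-closed ((n , e) ∷ u) a∈P =
      +-closed (*-closed (intCast∈P n) (evalMono-closed e a∈P)) (evalPoly-closed u a∈P)

  idempotent-shift-square : ∀ {y} w → y * y ≈ y →
                            (y + w) * (y + w) ≈ - (w + w * w) + (1# + (w + w)) * (y + w)
  idempotent-shift-square {y} w idem = begin
    (y + w) * (y + w)
      ≈⟨ solve 2 (λ y w → (y :+ w) :* (y :+ w) := y :* y :+ (w :* w :+ (w :+ w) :* y)) refl y w ⟩
    y * y + (w * w + (w + w) * y)
      ≈⟨ +-congʳ idem ⟩
    y + (w * w + (w + w) * y)
      ≈⟨ solve 2 (λ y w → y :+ (w :* w :+ (w :+ w) :* y)
                          := :- (w :+ w :* w) :+ ((y :+ w) :+ (w :+ w) :* (y :+ w))) refl y w ⟩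
    - (w + w * w) + ((y + w) + (w + w) * (y + w))      ≈⟨ +-congˡ (+-congʳ (sym (*-identityˡ _))) ⟩
    - (w + w * w) + (1# * (y + w) + (w + w) * (y + w)) ≈⟨ +-congˡ (sym (distribʳ _ _ _)) ⟩
    - (w + w * w) + (1# + (w + w)) * (y + w)           ∎

  affine-product : ∀ {Z α β} a b a′ b′ → Z * Z ≈ α + β * Z →
                   (a + b * Z) * (a′ + b′ * Z) ≈ (a * a′ + b * b′ * α) + (a * b′ + b * a′ + b * b′ * β) * Z
  affine-product {Z} {α} {β} a b a′ b′ Z²≈ = begin
    (a + b * Z) * (a′ + b′ * Z)
      ≈⟨ solve 5 (λ a b a′ b′ Z → (a :+ b :* Z) :* (a′ :+ b′ :* Z)
                                  := (a :* a′ :+ b :* b′ :* (Z :* Z)) :+ (a :* b′ :+ b :* a′) :* Z)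
                 refl a b a′ b′ Z ⟩
    (a * a′ + b * b′ * (Z * Z)) + (a * b′ + b * a′) * Z
      ≈⟨ +-congʳ (+-congˡ (*-congˡ Z²≈)) ⟩
    (a * a′ + b * b′ * (α + β * Z)) + (a * b′ + b * a′) * Z
      ≈⟨ solve 7 (λ a b a′ b′ Z α β → (a :* a′ :+ b :* b′ :* (α :+ β :* Z)) :+ (a :* b′ :+ b :* a′) :* Z
                                      := (a :* a′ :+ b :* b′ :* α) :+ (a :* b′ :+ b :* a′ :+ b :* b′ :* β) :* Z)
                 refl a b a′ b′ Z α β ⟩
    (a * a′ + b * b′ * α) + (a * b′ + b * a′ + b * b′ * β) * Z ∎

  evalMono-cong : ∀ {k} (e : Monomial k) {a a′ : Vector Carrier k} →
                  (∀ i → a i ≡ a′ i) → evalMono R e a ≡ evalMono R e a′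
  evalMono-cong {zero} e a≡a′ = ≡.refl
  evalMono-cong {suc k} e a≡a′ =
    ≡.cong₂ (λ u v → pow R u (e zero) * v) (a≡a′ zero) (evalMono-cong (tail e) (a≡a′ ∘ suc))

  evalPoly-cong : ∀ {k} (u : Poly k) {a a′ : Vector Carrier k} →
                  (∀ i → a i ≡ a′ i) → evalPoly R u a ≡ evalPoly R u a′
  evalPoly-cong [] a≡a′ = ≡.refl
  evalPoly-cong ((n , e) ∷ u) a≡a′ =
    ≡.cong₂ (λ m v → intCast R n * m + v) (evalMono-cong e a≡a′) (evalPoly-cong u a≡a′)

  evalPoly-++ : ∀ {k} (u v : Poly k) a → evalPoly R (u ++ v) a ≈ evalPoly R u a + evalPoly R v a
  evalPoly-++ [] v a = sym (+-identityˡ _)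
  evalPoly-++ (t ∷ u) v a = trans (+-congˡ (evalPoly-++ u v a)) (sym (+-assoc _ _ _))

  evalMono-snoc : ∀ {k} (e : Monomial k) j (a : Vector Carrier (suc k)) →
                  evalMono R (snoc e j) a ≈ evalMono R e (init a) * pow R (last a) j
  evalMono-snoc {zero} e j a = trans (*-identityʳ _) (sym (*-identityˡ _))
  evalMono-snoc {suc k} e j a = trans (*-congˡ (evalMono-snoc (tail e) j (tail a))) (sym (*-assoc _ _ _))

  extend : ∀ {k} → ℕ → Poly k → Poly (suc k)
  extend j = map (map₂ (λ e → snoc e j))

  evalPoly-extend : ∀ {k} j (u : Poly k) (a : Vector Carrier (suc k)) →
                    evalPoly R (extend j u) a ≈ evalPoly R u (init a) * pow R (last a) j
  evalPoly-extend j [] a = sym (zeroˡ _)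
  evalPoly-extend j ((n , e) ∷ u) a = begin
    intCast R n * evalMono R (snoc e j) a + evalPoly R (extend j u) a
      ≈⟨ +-cong (*-congˡ (evalMono-snoc e j a)) (evalPoly-extend j u a) ⟩
    intCast R n * (M * X) + U * X
      ≈⟨ solve 4 (λ n M X U → n :* (M :* X) :+ U :* X := (n :* M :+ U) :* X) refl (intCast R n) M X U ⟩
    (intCast R n * M + U) * X ∎
    where
    M = evalMono R e (init a)
    X = pow R (last a) j
    U = evalPoly R u (init a)

  IsCompliform-extend : ∀ {k} {j} {u : Poly k} → j ℕ.≤ 1 → IsCompliform u → IsCompliform (extend j u)
  IsCompliform-extend j≤1 = All.map⁺ ∘ All.map (λ e≤1 → snoc-preserves (ℕ._≤ 1) e≤1 j≤1)

  affinePoly : ∀ {k} → Poly k → Poly k → Poly (suc k)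
  affinePoly u v = extend 0 u ++ extend 1 v

  evalPoly-affinePoly : ∀ {k} (u v : Poly k) (a : Vector Carrier (suc k)) →
                        evalPoly R (affinePoly u v) a ≈ evalPoly R u (init a) + evalPoly R v (init a) * last a
  evalPoly-affinePoly u v a = begin
    evalPoly R (extend 0 u ++ extend 1 v) a
      ≈⟨ evalPoly-++ (extend 0 u) (extend 1 v) a ⟩
    evalPoly R (extend 0 u) a + evalPoly R (extend 1 v) a
      ≈⟨ +-cong (evalPoly-extend 0 u a) (evalPoly-extend 1 v a) ⟩
    evalPoly R u (init a) * 1# + evalPoly R v (init a) * (last a * 1#)
      ≈⟨ +-cong (*-identityʳ _) (*-congˡ (*-identityʳ _)) ⟩
    evalPoly R u (init a) + evalPoly R v (init a) * last a ∎

  IsCompliform-affinePoly : ∀ {k} {u v : Poly k} → IsCompliform u → IsCompliform v → IsCompliform (affinePoly u v)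
  IsCompliform-affinePoly cu cv = All.++⁺ (IsCompliform-extend z≤n cu) (IsCompliform-extend ≤-refl cv)

  module CompliformIn (z : ℕ → Carrier) where

    zs : (k : ℕ) → Vector Carrier k
    zs k i = z (toℕ i)

    data Compliform : ℕ → Pred Carrier (c ⊔ ℓ) where
      const  : ∀ {x} n → x ≈ intCast R n → x ∈ Compliform zero
      affine : ∀ {k x a b} → a ∈ Compliform k → b ∈ Compliform k → x ≈ a + b * z k → x ∈ Compliform (suc k)

    ∈-resp-≈ : ∀ {k x x′} → x ≈ x′ → x ∈ Compliform k → x′ ∈ Compliform k
    ∈-resp-≈ x≈x′ (const n x≈n) = const n (trans (sym x≈x′) x≈n)
    ∈-resp-≈ x≈x′ (affine a∈ b∈ x≈) = affine a∈ b∈ (trans (sym x≈x′) x≈)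

    x≈x+0*z : ∀ {k x} → x ≈ x + 0# * z k
    x≈x+0*z = sym (trans (+-congˡ (zeroˡ _)) (+-identityʳ _))

    intCast∈ : ∀ k n → intCast R n ∈ Compliform k
    intCast∈ zero n = const n refl
    intCast∈ (suc k) n = affine (intCast∈ k n) (intCast∈ k (+ 0)) x≈x+0*z

    1∈ : ∀ k → 1# ∈ Compliform k
    1∈ k = ∈-resp-≈ (+-identityʳ 1#) (intCast∈ k (+ 1))

    weaken : ∀ {k x} → x ∈ Compliform k → x ∈ Compliform (suc k)
    weaken x∈ = affine x∈ (intCast∈ _ (+ 0)) x≈x+0*z

    +-closed : ∀ {k x x′} → x ∈ Compliform k → x′ ∈ Compliform k → x + x′ ∈ Compliform k
    +-closed (const n x≈) (const n′ x′≈) = const (n ℤ.+ n′) (trans (+-cong x≈ x′≈) (sym (intCast-+ n n′)))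
    +-closed {suc k} (affine a∈ b∈ x≈) (affine a′∈ b′∈ x′≈) =
      affine (+-closed a∈ a′∈) (+-closed b∈ b′∈)
        (trans (+-cong x≈ x′≈)
               (solve 5 (λ a b a′ b′ Z → (a :+ b :* Z) :+ (a′ :+ b′ :* Z) := (a :+ a′) :+ (b :+ b′) :* Z)
                      refl _ _ _ _ (z k)))

    neg-closed : ∀ {k x} → x ∈ Compliform k → - x ∈ Compliform k
    neg-closed (const n x≈) = const (ℤ.- n) (trans (-‿cong x≈) (sym (intCast-neg n)))
    neg-closed {suc k} (affine a∈ b∈ x≈) =
      affine (neg-closed a∈) (neg-closed b∈)
        (trans (-‿cong x≈) (solve 3 (λ a b Z → :- (a :+ b :* Z) := :- a :+ (:- b) :* Z) refl _ _ (z k)))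

    MulClosed : ℕ → Set (c ⊔ ℓ)
    MulClosed k = ∀ {x x′} → x ∈ Compliform k → x′ ∈ Compliform k → x * x′ ∈ Compliform k

    *-closed-zero : MulClosed zero
    *-closed-zero (const n x≈) (const n′ x′≈) = const (n ℤ.* n′) (trans (*-cong x≈ x′≈) (sym (intCast-* n n′)))

    *-closed-suc : ∀ {k} → MulClosed k → z k * z k ∈ Compliform (suc k) → MulClosed (suc k)
    *-closed-suc *-closed (affine α∈ β∈ z²≈)
                 (affine {a = a} {b} a∈ b∈ x≈) (affine {a = a′} {b′} a′∈ b′∈ x′≈) =
      affine (+-closed (*-closed a∈ a′∈) (*-closed (*-closed b∈ b′∈) α∈))
             (+-closed (+-closed (*-closed a∈ b′∈) (*-closed b∈ a′∈)) (*-closed (*-closed b∈ b′∈) β∈))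
             (trans (*-cong x≈ x′≈) (affine-product a b a′ b′ z²≈))

    evalPoly∈ : ∀ {k m} → MulClosed k → (u : Poly m) {a : Vector Carrier m} →
                (∀ i → a i ∈ Compliform k) → evalPoly R u a ∈ Compliform k
    evalPoly∈ {k} *-closed = evalPoly-closed (Compliform k) (1∈ k) (intCast∈ k) +-closed *-closed

    toCompliformPoly : ∀ {k x} → x ∈ Compliform k →
                       ∃ λ (u : Poly k) → IsCompliform u × x ≈ evalPoly R u (zs k)
    toCompliformPoly (const n x≈n) =
      (n , λ ()) ∷ [] , (λ ()) ∷ [] , trans x≈n (sym (trans (+-identityʳ _) (*-identityʳ _)))
    toCompliformPoly {suc k} {x} (affine {a = a} {b} a∈ b∈ x≈)
      with toCompliformPoly a∈ | toCompliformPoly b∈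
    ... | u , u-compliform , a≈u | v , v-compliform , b≈v =
      affinePoly u v , IsCompliform-affinePoly u-compliform v-compliform , (begin
        x
          ≈⟨ x≈ ⟩
        a + b * z k
          ≈⟨ +-cong a≈u (*-congʳ b≈v) ⟩
        evalPoly R u (zs k) + evalPoly R v (zs k) * z k
          ≡⟨ ≡.cong₂ (λ U V → U + V * z k) (evalPoly-cong u init-zs) (evalPoly-cong v init-zs) ⟩
        evalPoly R u (init zs′) + evalPoly R v (init zs′) * z k
          ≡⟨ ≡.cong (λ Z → evalPoly R u (init zs′) + evalPoly R v (init zs′) * Z) last-zs ⟩
        evalPoly R u (init zs′) + evalPoly R v (init zs′) * last zs′
          ≈⟨ sym (evalPoly-affinePoly u v zs′) ⟩
        evalPoly R (affinePoly u v) zs′ ∎)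
      where
      zs′ = zs (suc k)
      init-zs : ∀ i → zs k i ≡ init zs′ i
      init-zs i = ≡.cong z (≡.sym (toℕ-inject₁ i))
      last-zs : z k ≡ last zs′
      last-zs = ≡.cong z (≡.sym (toℕ-fromℕ k))

  module Sequences (y z : ℕ → Carrier) (s : (m : ℕ) → Poly m)
                   (idem : ∀ n → y n * y n ≈ y n)
                   (z≈y+s[y] : ∀ m → z m ≈ y m + evalPoly R (s m) (λ i → y (toℕ i))) where
    open CompliformIn z

    ys : (k : ℕ) → Vector Carrier k
    ys k i = y (toℕ i)

    s[y] : ℕ → Carrier
    s[y] k = evalPoly R (s k) (ys k)

    y∈ : ∀ {k} → s[y] k ∈ Compliform k → y k ∈ Compliform (suc k)
    y∈ {k} w∈ = affine (neg-closed w∈) (1∈ k) (begin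
      y k                          ≈⟨ solve 2 (λ y w → y := :- w :+ (y :+ w)) refl (y k) (s[y] k) ⟩
      - s[y] k + (y k + s[y] k)    ≈⟨ +-congˡ (sym (*-identityˡ _)) ⟩
      - s[y] k + 1# * (y k + s[y] k) ≈⟨ +-congˡ (*-congˡ (sym (z≈y+s[y] k))) ⟩
      - s[y] k + 1# * z k          ∎)

    z²∈ : ∀ {k} → MulClosed k → s[y] k ∈ Compliform k → z k * z k ∈ Compliform (suc k)
    z²∈ {k} *-closed w∈ =
      affine (neg-closed (+-closed w∈ (*-closed w∈ w∈))) (+-closed (1∈ k) (+-closed w∈ w∈)) (begin
        z k * z k                                       ≈⟨ *-cong (z≈y+s[y] k) (z≈y+s[y] k) ⟩
        (y k + w) * (y k + w)                           ≈⟨ idempotent-shift-square w (idem k) ⟩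
        - (w + w * w) + (1# + (w + w)) * (y k + w)      ≈⟨ +-congˡ (*-congˡ (sym (z≈y+s[y] k))) ⟩
        - (w + w * w) + (1# + (w + w)) * z k            ∎)
      where w = s[y] k

    Invariant : ℕ → Set (c ⊔ ℓ)
    Invariant k = MulClosed k × (∀ {i} → i < k → y i ∈ Compliform k)

    evalPoly-y∈ : ∀ {k} → Invariant k → (u : Poly k) → evalPoly R u (ys k) ∈ Compliform k
    evalPoly-y∈ (*-closed , y<k∈) u = evalPoly∈ *-closed u (λ i → y<k∈ (toℕ<n i))

    invariant-suc : ∀ {k} → Invariant k → Invariant (suc k)
    invariant-suc {k} inv@(*-closed , y<k∈) = *-closed-suc *-closed (z²∈ *-closed w∈) , y<1+k∈
      where
      w∈ : s[y] k ∈ Compliform k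
      w∈ = evalPoly-y∈ inv (s k)
      y<1+k∈ : ∀ {i} → i < suc k → y i ∈ Compliform (suc k)
      y<1+k∈ i<1+k with m<1+n⇒m<n∨m≡n i<1+k
      ... | inj₁ i<k = weaken (y<k∈ i<k)
      ... | inj₂ ≡.refl = y∈ w∈

    invariant : ∀ k → Invariant k
    invariant zero = *-closed-zero , λ ()
    invariant (suc k) = invariant-suc (invariant k)

    poly-y-compliform-in-z : ∀ k (u : Poly k) →
      ∃ λ (v : Poly k) → IsCompliform v × evalPoly R u (ys k) ≈ evalPoly R v (zs k)
    poly-y-compliform-in-z k u = toCompliformPoly (evalPoly-y∈ (invariant k) u)

    y-compliform-in-z : ∀ k → ∃ λ (t : Poly k) → IsCompliform t × y k ≈ z k + evalPoly R t (zs k)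
    y-compliform-in-z k with toCompliformPoly (neg-closed (evalPoly-y∈ (invariant k) (s k)))
    ... | t , t-compliform , -w≈t = t , t-compliform , (begin
      y k                        ≈⟨ solve 2 (λ y w → y := (y :+ w) :+ :- w) refl (y k) (s[y] k) ⟩
      (y k + s[y] k) - s[y] k    ≈⟨ +-cong (sym (z≈y+s[y] k)) -w≈t ⟩
      z k + evalPoly R t (zs k)  ∎)

mainTheorem2 : ∀ {c ℓ} (R : CommutativeRing c ℓ) →
    let open CommutativeRing R in
    (y z : ℕ → Carrier) (s : (m : ℕ) → Poly m) →
    (∀ n → y n * y n ≈ y n) →
    (∀ m → z m ≈ y m + evalPoly R (s m) (λ i → y (toℕ i))) →
    ((k : ℕ) → ∃ λ (t : Poly k) →
        IsCompliform t × (y k ≈ z k + evalPoly R t (λ i → z (toℕ i))))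
    ×
    ((k : ℕ) (u : Poly k) → ∃ λ (v : Poly k) →
        IsCompliform v × (evalPoly R u (λ i → y (toℕ i)) ≈ evalPoly R v (λ i → z (toℕ i))))
mainTheorem2 R y z s idem z≈y+s[y] = y-compliform-in-z , poly-y-compliform-in-z
  where open Sequences R y z s idem z≈y+s[y]
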